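{- Let $G$ be a cycle and $m,r$ positive integers. Then $\sigma(G,m,r)\le\lceil r/m\rceil$. Moreover, equality holds when $m\mid r$ and $r/m\le|V(G)|$.
   Context: The game ${\rm RS}(G,m,r,s)$ is played on a graph $G$ by a team of $r$ revolutionaries and a team of $s$ spies. First the revolutionaries, then the spies, take positions at vertices (several players may share a vertex). In each subsequent round, each revolutionary may move to an adjacent vertex or stay put, and then each spy has the same option; all positions are known to everyone. A meeting is a set of at least $m$ revolutionaries on one vertex; it is unguarded if no spy is at that vertex. The revolutionaries win if at the end of some round (including the initial placement) there is an unguarded meeting; the spies win if they can prevent this forever. $\sigma(G,m,r)$ denotes the minimum $s$ such that the spies win ${\rm RS}(G,m,r,s)$. -}

module Defs where

open import Data.Nat using (ℕ; zero; suc; _+_; _∸_; _≤_; _<_; NonZero)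
open import Data.Nat.DivMod using (_/_; _%_)
open import Data.Fin using (Fin; toℕ) renaming (zero to fzero; suc to fsuc)
open import Data.Fin.Properties using (_≟_)
open import Data.Product using (Σ; _×_; _,_; proj₁; proj₂; ∃-syntax)
open import Data.Sum using (_⊎_)
open import Data.List using (List; []; _∷_)
open import Relation.Nullary using (¬_; yes; no)
open import Relation.Binary.PropositionalEquality using (_≡_; _≢_)

⌈_/_⌉ : (r m : ℕ) → .{{NonZero m}} → ℕ
⌈ r / m ⌉ = (r + (m ∸ 1)) / m

-- The cycle C_n on vertex set Fin n: vertex i is adjacent to i+1 mod n
-- (the graph is a cycle when n ≥ 3, which the theorem assumes).

CycAdj : (n : ℕ) → Fin n → Fin n → Set
CycAdj (suc k) i j = (toℕ j ≡ (toℕ i + 1) % suc k) ⊎ (toℕ i ≡ (toℕ j + 1) % suc k)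

Step : (n : ℕ) → Fin n → Fin n → Set
Step n i j = (i ≡ j) ⊎ CycAdj n i j

Pos : ℕ → ℕ → Set
Pos n t = Fin t → Fin n

TeamStep : (n t : ℕ) → Pos n t → Pos n t → Set
TeamStep n t P Q = (i : Fin t) → Step n (P i) (Q i)

countAt : {n t : ℕ} → Pos n t → Fin n → ℕ
countAt {t = zero}  P v = 0
countAt {t = suc t} P v with P fzero ≟ v
... | yes _ = suc (countAt (λ i → P (fsuc i)) v)
... | no  _ = countAt (λ i → P (fsuc i)) v

Conf : (n r s : ℕ) → Set
Conf n r s = Pos n r × Pos n s

UnguardedMeeting : (n m r s : ℕ) → Conf n r s → Set
UnguardedMeeting n m r s (R , S) =
  ∃[ v ] ((m ≤ countAt R v) × ((j : Fin s) → S j ≢ v))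

-- Strategies (full information, history dependent).
-- A history is the list of configurations at the ends of all earlier
-- rounds (most recent first), together with the current configuration.

record SpyStrategy (n r s : ℕ) : Set where
  field
    init : Pos n r → Pos n s
    move : List (Conf n r s) → Conf n r s → Pos n r → Pos n s
    move-legal : (h : List (Conf n r s)) (c : Conf n r s) (R' : Pos n r) →
                 TeamStep n s (proj₂ c) (move h c R')

record RevStrategy (n r s : ℕ) : Set where
  field
    init : Pos n r
    move : List (Conf n r s) → Conf n r s → Pos n r
    move-legal : (h : List (Conf n r s)) (c : Conf n r s) →
                 TeamStep n r (proj₁ c) (move h c)

-- The play: history and configuration at the end of round k
-- (round 0 = the initial placement).
play : {n r s : ℕ} → SpyStrategy n r s → RevStrategy n r s → ℕ →
       List (Conf n r s) × Conf n r s
play σ ρ zero = [] , (RevStrategy.init ρ , SpyStrategy.init σ (RevStrategy.init ρ))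
play σ ρ (suc k) with play σ ρ k
... | h , c = (c ∷ h) , (R' , SpyStrategy.move σ h c R')
  where R' = RevStrategy.move ρ h c

SpiesWin : (n m r s : ℕ) → Set
SpiesWin n m r s =
  Σ (SpyStrategy n r s) λ σ → (ρ : RevStrategy n r s) (k : ℕ) →
    ¬ UnguardedMeeting n m r s (proj₂ (play σ ρ k))

module Submission where

-- Unroll the cycle C_N onto the half-line: a revolutionary at vertex a has lifts a, a + N, a + 2N, …;
-- numbering all lifts in increasing order, lift number t + r lies N above lift number t.
-- Spy j shadows lift number j * m + c, projected back to the cycle. When the revolutionaries move,
-- renumbering the lifts by the total winding of the move keeps each shadowed lift within one step of
-- its old place shifted by N, so the spies can follow. Revolutionaries meeting at v give m consecutive
-- lift numbers at one place above v, and the numbers j * m + κ * r with j < ⌈ r / m ⌉ leave no gap of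
-- length m, so one of them is shadowed. Conversely, if m ∣ r, groups of m revolutionaries on r / m
-- distinct vertices cannot all be guarded by fewer than r / m spies.

open import Defs
open import Data.Nat
open import Data.Nat.Properties
open import Data.Nat.DivMod
open import Data.Nat.Divisibility using (_∣_; n∣m*n)
open import Data.Fin using (Fin; toℕ; fromℕ<; inject≤) renaming (zero to fzero; suc to fsuc)
open import Data.Fin.Properties using (toℕ<n; toℕ≤n; toℕ-injective; toℕ-fromℕ<; inject≤-injective; injective⇒≤; any?; ¬∀⟶∃¬)
  renaming (_≟_ to _≟ᶠ_)
open import Data.List using (List; []; _∷_)
open import Data.Product using (∃; ∃₂; _×_; _,_; proj₁; proj₂; ∃-syntax)
open import Data.Sum using (_⊎_; inj₁; inj₂)
open import Function using (_∘_)
open import Function.Definitions using (Injective)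
open import Relation.Nullary using (¬_; Dec; yes; no; contradiction)
open import Relation.Nullary.Decidable using (_⊎-dec_)
open import Relation.Binary.PropositionalEquality
open import Data.Nat.Tactic.RingSolver using (solve-∀)
open import Algebra.Properties.CommutativeSemigroup +-commutativeSemigroup using (x∙yz≈xz∙y; x∙yz≈y∙xz; xy∙z≈xz∙y; xy∙z≈x∙zy; xy∙z≈yz∙x)
open import Algebra.Properties.CommutativeMonoid.Sum +-0-commutativeMonoid using (sum; ∑-distrib-+)

[m+kn]/n≡m/n+k : ∀ m k n .{{_ : NonZero n}} → (m + k * n) / n ≡ m / n + k
[m+kn]/n≡m/n+k m k n = trans (+-distrib-/-∣ʳ m (n∣m*n k)) (cong (m / n +_) (m*n/n≡m k n))

m+kn≤o⇒m/n+k≤o/n : ∀ {m o} k n .{{_ : NonZero n}} → m + k * n ≤ o → m / n + k ≤ o / n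
m+kn≤o⇒m/n+k≤o/n {m} k n le =
  ≤-trans (≤-reflexive (sym ([m+kn]/n≡m/n+k m k n))) (/-monoˡ-≤ n le)

m≤o+kn⇒m/n≤o/n+k : ∀ {m o} k n .{{_ : NonZero n}} → m ≤ o + k * n → m / n ≤ o / n + k
m≤o+kn⇒m/n≤o/n+k {o = o} k n le =
  ≤-trans (/-monoˡ-≤ n le) (≤-reflexive ([m+kn]/n≡m/n+k o k n))

[g*m≤x<g*m+m]⇒x/m≡g : ∀ {x g} m .{{_ : NonZero m}} → g * m ≤ x → x < g * m + m → x / m ≡ g
[g*m≤x<g*m+m]⇒x/m≡g {x} {g} m lo hi = ≤-antisym
  (s≤s⁻¹ (m<n*o⇒m/o<n (subst (x <_) (+-comm (g * m) m) hi)))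
  (≤-trans (≤-reflexive (sym (m*n/n≡m g m))) (/-monoˡ-≤ m lo))

m≤⌈m/n⌉*n : ∀ m n .{{_ : NonZero n}} → m ≤ ⌈ m / n ⌉ * n
m≤⌈m/n⌉*n m n@(suc n-1) = +-cancelʳ-≤ n-1 m _ (begin
  m + n-1                           ≡⟨ m≡m%n+[m/n]*n (m + n-1) n ⟩
  (m + n-1) % n + ⌈ m / n ⌉ * n     ≤⟨ +-monoˡ-≤ _ (<⇒≤pred (m%n<n (m + n-1) n)) ⟩
  n-1 + ⌈ m / n ⌉ * n               ≡⟨ +-comm n-1 _ ⟩
  ⌈ m / n ⌉ * n + n-1               ∎)
  where open ≤-Reasoning

⌈m/n⌉*n<m+n : ∀ m n .{{_ : NonZero n}} → ⌈ m / n ⌉ * n < m + n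
⌈m/n⌉*n<m+n m n@(suc n-1) = ≤-<-trans (m/n*n≤m (m + n-1) n) (+-monoʳ-< m (n<1+n n-1))

⌈m/n⌉>0 : ∀ m n .{{_ : NonZero m}} .{{_ : NonZero n}} → ⌈ m / n ⌉ > 0
⌈m/n⌉>0 m n = n≢0⇒n>0 λ q≡0 → <⇒≱ (>-nonZero⁻¹ m) (subst (λ q → m ≤ q * n) q≡0 (m≤⌈m/n⌉*n m n))

jm+κr-in-window : ∀ r m .{{_ : NonZero r}} .{{_ : NonZero m}} u →
                 ∃₂ λ j κ → j < ⌈ r / m ⌉ × u ≤ j * m + κ * r × j * m + κ * r < u + m
jm+κr-in-window r m u with ⌈ u % r / m ⌉ <? ⌈ r / m ⌉
... | yes j<q = ⌈ ρ / m ⌉ , κ , j<q , lo , hi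
  where
  open ≤-Reasoning
  ρ = u % r
  κ = u / r
  lo = begin
    u                      ≡⟨ m≡m%n+[m/n]*n u r ⟩
    ρ + κ * r              ≤⟨ +-monoˡ-≤ (κ * r) (m≤⌈m/n⌉*n ρ m) ⟩
    ⌈ ρ / m ⌉ * m + κ * r  ∎
  hi = begin-strict
    ⌈ ρ / m ⌉ * m + κ * r  <⟨ +-monoˡ-< (κ * r) (⌈m/n⌉*n<m+n ρ m) ⟩
    ρ + m + κ * r          ≡⟨ xy∙z≈xz∙y ρ m (κ * r) ⟩
    ρ + κ * r + m          ≡⟨ cong (_+ m) (m≡m%n+[m/n]*n u r) ⟨
    u + m                  ∎
... | no j≮q = 0 , suc κ , ⌈m/n⌉>0 r m , lo , hi
  where
  open ≤-Reasoning
  ρ = u % r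
  κ = u / r
  lo = begin
    u                      ≡⟨ m≡m%n+[m/n]*n u r ⟩
    ρ + κ * r              ≤⟨ +-monoˡ-≤ (κ * r) (<⇒≤ (m%n<n u r)) ⟩
    r + κ * r              ∎
  hi = begin-strict
    r + κ * r              ≤⟨ +-monoˡ-≤ (κ * r) (m≤⌈m/n⌉*n r m) ⟩
    ⌈ r / m ⌉ * m + κ * r  ≤⟨ +-monoˡ-≤ (κ * r) (*-monoˡ-≤ m (≮⇒≥ j≮q)) ⟩
    ⌈ ρ / m ⌉ * m + κ * r  <⟨ +-monoˡ-< (κ * r) (⌈m/n⌉*n<m+n ρ m) ⟩
    ρ + m + κ * r          ≡⟨ xy∙z≈xz∙y ρ m (κ * r) ⟩
    ρ + κ * r + m          ≡⟨ cong (_+ m) (m≡m%n+[m/n]*n u r) ⟨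
    u + m                  ∎

record Least (g : ℕ → ℕ) (t x : ℕ) : Set where
  field
    reached : t ≤ g x
    minimal : ∀ {y} → t ≤ g y → x ≤ y

open Least

least : (g : ℕ → ℕ) (t b : ℕ) → t ≤ g b → ∃ (Least g t)
least g t zero    t≤g0 = 0 , record { reached = t≤g0 ; minimal = λ _ → z≤n }
least g t (suc b) t≤gb with t ≤? g 0
... | yes t≤g0 = 0 , record { reached = t≤g0 ; minimal = λ _ → z≤n }
... | no  t≰g0 with least (g ∘ suc) t b t≤gb
...   | x , L = suc x , record { reached = reached L ; minimal = minimal′ }
  where
  minimal′ : ∀ {y} → t ≤ g y → suc x ≤ y
  minimal′ {zero}  t≤g0 = contradiction t≤g0 t≰g0
  minimal′ {suc y} t≤gy = s≤s (minimal L t≤gy)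

module _ {g h : ℕ → ℕ} {t x y : ℕ} (Lg : Least g t x) where

  least-shiftʳ : ∀ {w k} → Least h (t + w) y → (∀ z → g z + w ≤ h (z + k)) → y ≤ x + k
  least-shiftʳ {w} Lh g+w≤h = minimal Lh (≤-trans (+-monoˡ-≤ w (reached Lg)) (g+w≤h x))

  least-shiftˡ : ∀ {w k} → Least h (t + w) y → (∀ z → h z ≤ g (z ∸ k) + w) → g 0 < t → x + k ≤ y
  least-shiftˡ {w} {k} Lh h≤g+w g0<t = m≤o∸n⇒m+n≤o x k≤y x≤y∸k
    where
    x≤y∸k : x ≤ y ∸ k
    x≤y∸k = minimal Lg (+-cancelʳ-≤ w t _ (≤-trans (reached Lh) (h≤g+w y)))
    0<x : 0 < x
    0<x = n≢0⇒n>0 λ x≡0 → <⇒≱ g0<t (subst (λ x → t ≤ g x) x≡0 (reached Lg))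
    k≤y : k ≤ y
    k≤y = <⇒≤ (m∸n≢0⇒n<m (n>0⇒n≢0 (<-≤-trans 0<x x≤y∸k)))

least-at-jump : ∀ {g t x z} → (∀ {a b} → a ≤ b → g a ≤ g b) →
                Least g t x → g z < t → t ≤ g (suc z) → x ≡ suc z
least-at-jump mono L gz<t t≤gsz =
  ≤-antisym (minimal L t≤gsz) (≰⇒> λ x≤z → <⇒≱ gz<t (≤-trans (reached L) (mono x≤z)))

sum-mono-≤ : ∀ {t} {f g : Fin t → ℕ} → (∀ i → f i ≤ g i) → sum f ≤ sum g
sum-mono-≤ {zero}  f≤g = z≤n
sum-mono-≤ {suc t} f≤g = +-mono-≤ (f≤g fzero) (sum-mono-≤ (f≤g ∘ fsuc))

sum-1 : ∀ t → sum {t} (λ _ → 1) ≡ t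
sum-1 zero    = refl
sum-1 (suc t) = cong suc (sum-1 t)

≤-sum : ∀ {t} (f : Fin t → ℕ) i → f i ≤ sum f
≤-sum f fzero    = m≤m+n (f fzero) _
≤-sum f (fsuc i) = ≤-trans (≤-sum (f ∘ fsuc) i) (m≤n+m _ (f fzero))

module _ {n : ℕ} where

  countAt-tail-≤ : ∀ {t} (P : Pos n (suc t)) v → countAt (P ∘ fsuc) v ≤ countAt P v
  countAt-tail-≤ P v with P fzero ≟ᶠ v
  ... | yes _ = n≤1+n _
  ... | no  _ = ≤-refl

  countAt-head : ∀ {t} (P : Pos n (suc t)) v → P fzero ≡ v → countAt P v ≡ suc (countAt (P ∘ fsuc) v)
  countAt-head P v P0≡v with P fzero ≟ᶠ v
  ... | yes _     = refl
  ... | no  P0≢v = contradiction P0≡v P0≢v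

  countAt-run : ∀ {t} (P : Pos n t) v a m → a + m ≤ t →
                (∀ i → a ≤ toℕ i → toℕ i < a + m → P i ≡ v) → m ≤ countAt P v
  countAt-run P v a zero _ _ = z≤n
  countAt-run {suc t} P v zero (suc m) (s≤s m≤t) run = begin
    suc m                          ≤⟨ s≤s (countAt-run (P ∘ fsuc) v 0 m m≤t λ i _ i<m → run (fsuc i) z≤n (s≤s i<m)) ⟩
    suc (countAt (P ∘ fsuc) v)     ≡⟨ countAt-head P v (run fzero z≤n z<s) ⟨
    countAt P v                    ∎
    where open ≤-Reasoning
  countAt-run {suc t} P v (suc a) m (s≤s a+m≤t) run =
    ≤-trans (countAt-run (P ∘ fsuc) v a m a+m≤t λ i a≤i i<a+m → run (fsuc i) (s≤s a≤i) (s≤s i<a+m))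
            (countAt-tail-≤ P v)

  sum+countAt≤sum : ∀ {t} (P : Pos n t) v (f g : Fin t → ℕ) → (∀ i → f i ≤ g i) →
                    (∀ i → P i ≡ v → suc (f i) ≤ g i) → sum f + countAt P v ≤ sum g
  sum+countAt≤sum {zero}  P v f g f≤g jump = z≤n
  sum+countAt≤sum {suc t} P v f g f≤g jump with P fzero ≟ᶠ v
  ... | yes P0≡v = begin
    f fzero + sum (f ∘ fsuc) + suc (countAt (P ∘ fsuc) v)     ≡⟨ trans (+-suc _ _) (cong suc (+-assoc (f fzero) _ _)) ⟩
    suc (f fzero) + (sum (f ∘ fsuc) + countAt (P ∘ fsuc) v)   ≤⟨ +-mono-≤ (jump fzero P0≡v) rest ⟩
    g fzero + sum (g ∘ fsuc)                                  ∎
    where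
    open ≤-Reasoning
    rest = sum+countAt≤sum (P ∘ fsuc) v (f ∘ fsuc) (g ∘ fsuc) (f≤g ∘ fsuc) (jump ∘ fsuc)
  ... | no _ = begin
    f fzero + sum (f ∘ fsuc) + countAt (P ∘ fsuc) v     ≡⟨ +-assoc (f fzero) _ _ ⟩
    f fzero + (sum (f ∘ fsuc) + countAt (P ∘ fsuc) v)   ≤⟨ +-mono-≤ (f≤g fzero) rest ⟩
    g fzero + sum (g ∘ fsuc)                            ∎
    where
    open ≤-Reasoning
    rest = sum+countAt≤sum (P ∘ fsuc) v (f ∘ fsuc) (g ∘ fsuc) (f≤g ∘ fsuc) (jump ∘ fsuc)

module Lifts (N : ℕ) .{{_ : NonZero N}} where

  -- For a ≤ N this counts the lifts a, a + N, a + 2N, … of a vertex a that lie in [0, x].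
  lifts : ℕ → ℕ → ℕ
  lifts a x = (x + N ∸ a) / N

  lifts-mono : ∀ a {x y} → x ≤ y → lifts a x ≤ lifts a y
  lifts-mono a x≤y = /-monoˡ-≤ N (∸-monoˡ-≤ a (+-monoˡ-≤ N x≤y))

  lifts-0 : ∀ a → lifts a 0 ≤ 1
  lifts-0 a = ≤-trans (/-monoˡ-≤ N (m∸n≤m N a)) (≤-reflexive (n/n≡1 N))

  lifts-unbounded : ∀ {a} c → a ≤ N → c ≤ lifts a (c * N)
  lifts-unbounded {a} c a≤N = begin
    c                    ≡⟨ m*n/n≡m c N ⟨
    c * N / N            ≤⟨ /-monoˡ-≤ N (m≤m+n (c * N) (N ∸ a)) ⟩
    (c * N + (N ∸ a)) / N ≡⟨ cong (_/ N) (+-∸-assoc (c * N) a≤N) ⟨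
    lifts a (c * N)      ∎
    where open ≤-Reasoning

  lifts-lift : ∀ a x → lifts a (a + x) ≡ suc (x / N)
  lifts-lift a x = begin-equality
    (a + x + N ∸ a) / N  ≡⟨ cong (λ y → (y ∸ a) / N) (+-assoc a x N) ⟩
    (a + (x + N) ∸ a) / N ≡⟨ cong (_/ N) (m+n∸m≡n a (x + N)) ⟩
    (x + N) / N          ≡⟨ cong (λ y → (x + y) / N) (*-identityˡ N) ⟨
    (x + 1 * N) / N      ≡⟨ [m+kn]/n≡m/n+k x 1 N ⟩
    x / N + 1            ≡⟨ +-comm (x / N) 1 ⟩
    suc (x / N)          ∎
    where open ≤-Reasoning

  lifts-jump : ∀ a c → lifts a (a + (pred N + c * N)) < lifts a (suc (a + (pred N + c * N)))
  lifts-jump a c = begin-strict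
    lifts a (a + (pred N + c * N))      ≡⟨ lifts-lift a (pred N + c * N) ⟩
    suc ((pred N + c * N) / N)          ≡⟨ cong suc ([m+kn]/n≡m/n+k (pred N) c N) ⟩
    suc (pred N / N + c)                ≡⟨ cong (λ q → suc (q + c)) (m<n⇒m/n≡0 (≤-reflexive (suc-pred N))) ⟩
    suc c                               <⟨ n<1+n (suc c) ⟩
    suc (suc c)                         ≡⟨ cong suc (m*n/n≡m (suc c) N) ⟨
    suc (suc c * N / N)                 ≡⟨ cong (λ y → suc ((y + c * N) / N)) (suc-pred N) ⟨
    suc (suc (pred N + c * N) / N)      ≡⟨ lifts-lift a (suc (pred N + c * N)) ⟨
    lifts a (a + suc (pred N + c * N))  ≡⟨ cong (lifts a) (+-suc a _) ⟩
    lifts a (suc (a + (pred N + c * N))) ∎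
    where open ≤-Reasoning

  lifts-shiftʳ : ∀ {a b w k} x → a ≤ N → b + w * N ≤ a + k → lifts a x + w ≤ lifts b (x + k)
  lifts-shiftʳ {a} {b} {w} {k} x a≤N b+wN≤a+k = m+kn≤o⇒m/n+k≤o/n w N (m+n≤o⇒m≤o∸n _ (begin
    x + N ∸ a + w * N + b    ≡⟨ xy∙z≈x∙zy (x + N ∸ a) (w * N) b ⟩
    x + N ∸ a + (b + w * N)  ≤⟨ +-monoʳ-≤ (x + N ∸ a) b+wN≤a+k ⟩
    x + N ∸ a + (a + k)      ≡⟨ +-assoc (x + N ∸ a) a k ⟨
    x + N ∸ a + a + k        ≡⟨ cong (_+ k) (m∸n+n≡m (≤-trans a≤N (m≤n+m N x))) ⟩
    x + N + k                ≡⟨ xy∙z≈xz∙y x N k ⟩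
    x + k + N                ∎))
    where open ≤-Reasoning

  lifts-shiftˡ : ∀ {a b w k} x → a ≤ N → a + k ≤ b + w * N → lifts b x ≤ lifts a (x ∸ k) + w
  lifts-shiftˡ {a} {b} {w} {k} x a≤N a+k≤b+wN = m≤o+kn⇒m/n≤o/n+k w N (m≤n+o⇒m∸n≤o (x + N) b (begin
    x + N                  ≤⟨ +-monoˡ-≤ N (m≤n+m∸n x k) ⟩
    k + (x ∸ k) + N        ≡⟨ xy∙z≈yz∙x k (x ∸ k) N ⟩
    X + k                  ≡⟨ cong (_+ k) (m∸n+n≡m (≤-trans a≤N (m≤n+m N (x ∸ k)))) ⟨
    X ∸ a + a + k          ≡⟨ +-assoc (X ∸ a) a k ⟩
    X ∸ a + (a + k)        ≤⟨ +-monoʳ-≤ (X ∸ a) a+k≤b+wN ⟩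
    X ∸ a + (b + w * N)    ≡⟨ x∙yz≈y∙xz (X ∸ a) b (w * N) ⟩
    b + (X ∸ a + w * N)    ∎))
    where
    open ≤-Reasoning
    X = x ∸ k + N

  liftCount : ∀ {r} → Pos N r → ℕ → ℕ
  liftCount R x = sum λ i → lifts (toℕ (R i)) x

  module _ {r : ℕ} where

    liftCount-mono : (R : Pos N r) → ∀ {x y} → x ≤ y → liftCount R x ≤ liftCount R y
    liftCount-mono R x≤y = sum-mono-≤ λ i → lifts-mono (toℕ (R i)) x≤y

    liftCount-0 : (R : Pos N r) → liftCount R 0 ≤ r
    liftCount-0 R = ≤-trans (sum-mono-≤ λ i → lifts-0 (toℕ (R i))) (≤-reflexive (sum-1 r))

    liftCount-shiftʳ : (R R′ : Pos N r) (w : Fin r → ℕ) {k : ℕ} →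
                       (∀ i → toℕ (R′ i) + w i * N ≤ toℕ (R i) + k) →
                       ∀ x → liftCount R x + sum w ≤ liftCount R′ (x + k)
    liftCount-shiftʳ R R′ w {k} moves x = begin
      liftCount R x + sum w                         ≡⟨ ∑-distrib-+ (λ i → lifts (toℕ (R i)) x) w ⟨
      sum (λ i → lifts (toℕ (R i)) x + w i)         ≤⟨ sum-mono-≤ (λ i → lifts-shiftʳ x (toℕ≤n (R i)) (moves i)) ⟩
      liftCount R′ (x + k)                          ∎
      where open ≤-Reasoning

    liftCount-shiftˡ : (R R′ : Pos N r) (w : Fin r → ℕ) {k : ℕ} →
                       (∀ i → toℕ (R i) + k ≤ toℕ (R′ i) + w i * N) →
                       ∀ x → liftCount R′ x ≤ liftCount R (x ∸ k) + sum w
    liftCount-shiftˡ R R′ w {k} moves x = begin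
      liftCount R′ x                                ≤⟨ sum-mono-≤ (λ i → lifts-shiftˡ x (toℕ≤n (R i)) (moves i)) ⟩
      sum (λ i → lifts (toℕ (R i)) (x ∸ k) + w i)   ≡⟨ ∑-distrib-+ (λ i → lifts (toℕ (R i)) (x ∸ k)) w ⟩
      liftCount R (x ∸ k) + sum w                   ∎
      where open ≤-Reasoning

    liftCount-jump : (R : Pos N r) → ∀ v c →
                     let z = toℕ v + (pred N + c * N) in liftCount R z + countAt R v ≤ liftCount R (suc z)
    liftCount-jump R v c = sum+countAt≤sum R v _ _ (λ i → lifts-mono (toℕ (R i)) (n≤1+n z))
      λ i Ri≡v → subst (λ u → lifts (toℕ u) z < lifts (toℕ u) (suc z)) (sym Ri≡v) (lifts-jump (toℕ v) c)
      where z = toℕ v + (pred N + c * N)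

  module _ {r : ℕ} (R : Pos N (suc r)) where

    liftCount-unbounded : ∀ c → c ≤ liftCount R (c * N)
    liftCount-unbounded c = ≤-trans (lifts-unbounded c (toℕ≤n (R fzero))) (≤-sum (λ i → lifts (toℕ (R i)) (c * N)) fzero)

    opaque
      -- The position of the t-th lifted revolutionary, numbering them from 1 in increasing order.
      position : ℕ → ℕ
      position t = proj₁ (least (liftCount R) t (t * N) (liftCount-unbounded t))

      position-least : ∀ t → Least (liftCount R) t (position t)
      position-least t = proj₂ (least (liftCount R) t (t * N) (liftCount-unbounded t))

  module _ {r : ℕ} (R R′ : Pos N (suc r)) (w : Fin (suc r) → ℕ) {k : ℕ} where

    position-shiftʳ : (∀ i → toℕ (R′ i) + w i * N ≤ toℕ (R i) + k) →
                      ∀ t → position R′ (t + sum w) ≤ position R t + k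
    position-shiftʳ moves t =
      least-shiftʳ (position-least R t) (position-least R′ _) (liftCount-shiftʳ R R′ w moves)

    position-shiftˡ : (∀ i → toℕ (R i) + k ≤ toℕ (R′ i) + w i * N) →
                      ∀ t → liftCount R 0 < t → position R t + k ≤ position R′ (t + sum w)
    position-shiftˡ moves t =
      least-shiftˡ (position-least R t) (position-least R′ _) (liftCount-shiftˡ R R′ w moves)

  module _ {r : ℕ} (R : Pos N (suc r)) where

    position-+r : ∀ {t} → liftCount R 0 < t → position R (t + suc r) ≡ position R t + N
    position-+r {t} R0<t = ≤-antisym
      (subst (λ u → position R u ≤ position R t + N) t+∑1≡t+r (position-shiftʳ R R (λ _ → 1) (≤-reflexive ∘ stay) t))
      (subst (λ u → position R t + N ≤ position R u) t+∑1≡t+r (position-shiftˡ R R (λ _ → 1) (≤-reflexive ∘ sym ∘ stay) t R0<t))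
      where
      stay : ∀ i → toℕ (R i) + 1 * N ≡ toℕ (R i) + N
      stay i = cong (toℕ (R i) +_) (*-identityˡ N)
      t+∑1≡t+r : t + sum {suc r} (λ _ → 1) ≡ t + suc r
      t+∑1≡t+r = cong (t +_) (sum-1 (suc r))

    position-+kr : ∀ {t} → liftCount R 0 < t → ∀ k → position R (t + k * suc r) ≡ position R t + k * N
    position-+kr {t} R0<t zero    = trans (cong (position R) (+-identityʳ t)) (sym (+-identityʳ _))
    position-+kr {t} R0<t (suc k) = begin-equality
      position R (t + (suc r + k * suc r))  ≡⟨ cong (position R) (x∙yz≈xz∙y t (suc r) _) ⟩
      position R (t + k * suc r + suc r)    ≡⟨ position-+r (<-≤-trans R0<t (m≤m+n t _)) ⟩
      position R (t + k * suc r) + N        ≡⟨ cong (_+ N) (position-+kr R0<t k) ⟩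
      position R t + k * N + N              ≡⟨ x∙yz≈xz∙y (position R t) N _ ⟨
      position R t + (N + k * N)            ∎
      where open ≤-Reasoning

private
  lift-stay : ∀ x n → x + 1 * n + 1 ≡ x + suc n
  lift-stay = solve-∀
  lift-up : ∀ x n → x + 1 + 1 * n + 0 ≡ x + suc n
  lift-up = solve-∀
  lift-wrap-up : ∀ x → 0 + 2 * (x + 1) + 0 ≡ x + suc (x + 1)
  lift-wrap-up = solve-∀
  lift-down : ∀ x n → x + 1 * n + 2 ≡ x + 1 + suc n
  lift-down = solve-∀
  lift-wrap-down : ∀ x → x + 0 * (x + 1) + 2 ≡ 0 + suc (x + 1)
  lift-wrap-down = solve-∀

module Cycle (k : ℕ) where

  N : ℕ
  N = 3 + k

  open Lifts N public

  -- One more than the winding number of a move a → b: the lift of b nearest to a + N is b + wind a b * N.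
  wind : Fin N → Fin N → ℕ
  wind a b = (toℕ a + suc N ∸ toℕ b) / N

  [x+1]%N : ∀ {x} → x < N → (x + 1) % N ≡ x + 1 ⊎ x + 1 ≡ N × (x + 1) % N ≡ 0
  [x+1]%N {x} x<N with m≤n⇒m<n∨m≡n (subst (_≤ N) (+-comm 1 x) x<N)
  ... | inj₁ x+1<N = inj₁ (m<n⇒m%n≡m x+1<N)
  ... | inj₂ x+1≡N = inj₂ (x+1≡N , trans (cong (_% N) x+1≡N) (n%n≡0 N))

  step-lift : ∀ {a b} → Step N a b → ∃₂ λ w δ → δ ≤ 2 × toℕ b + w * N + δ ≡ toℕ a + suc N
  step-lift {a} (inj₁ refl) = 1 , 1 , s≤s z≤n , lift-stay (toℕ a) N
  step-lift {a} {b} (inj₂ (inj₁ b≡[a+1]%N)) with [x+1]%N (toℕ<n a)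
  ... | inj₁ [a+1]%N≡a+1 =
    1 , 0 , z≤n , trans (cong (λ y → y + 1 * N + 0) (trans b≡[a+1]%N [a+1]%N≡a+1)) (lift-up (toℕ a) N)
  ... | inj₂ (a+1≡N , [a+1]%N≡0) =
    2 , 0 , z≤n , subst (λ n → toℕ b + 2 * n + 0 ≡ toℕ a + suc n) a+1≡N
      (trans (cong (λ y → y + 2 * (toℕ a + 1) + 0) (trans b≡[a+1]%N [a+1]%N≡0)) (lift-wrap-up (toℕ a)))
  step-lift {a} {b} (inj₂ (inj₂ a≡[b+1]%N)) with [x+1]%N (toℕ<n b)
  ... | inj₁ [b+1]%N≡b+1 =
    1 , 2 , ≤-refl , trans (lift-down (toℕ b) N) (cong (_+ suc N) (sym (trans a≡[b+1]%N [b+1]%N≡b+1)))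
  ... | inj₂ (b+1≡N , [b+1]%N≡0) =
    0 , 2 , ≤-refl , subst (λ n → toℕ b + 0 * n + 2 ≡ toℕ a + suc n) b+1≡N
      (trans (lift-wrap-down (toℕ b)) (cong (λ y → y + suc (toℕ b + 1)) (sym (trans a≡[b+1]%N [b+1]%N≡0))))

  wind-exact : ∀ {a b w δ} → toℕ b + w * N + δ ≡ toℕ a + suc N → δ < N → wind a b ≡ w
  wind-exact {a} {b} {w} {δ} lift δ<N = begin-equality
    (toℕ a + suc N ∸ toℕ b) / N        ≡⟨ cong (λ y → (y ∸ toℕ b) / N) lift ⟨
    (toℕ b + w * N + δ ∸ toℕ b) / N    ≡⟨ cong (λ y → (y ∸ toℕ b) / N) (x∙yz≈xz∙y (toℕ b) δ (w * N)) ⟨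
    (toℕ b + (δ + w * N) ∸ toℕ b) / N  ≡⟨ cong (_/ N) (m+n∸m≡n (toℕ b) _) ⟩
    (δ + w * N) / N                    ≡⟨ [m+kn]/n≡m/n+k δ w N ⟩
    δ / N + w                          ≡⟨ cong (_+ w) (m<n⇒m/n≡0 δ<N) ⟩
    w                                  ∎
    where open ≤-Reasoning

  step-moves : ∀ {a b} → Step N a b →
               toℕ b + wind a b * N ≤ toℕ a + suc N × toℕ a + pred N ≤ toℕ b + wind a b * N
  step-moves {a} {b} step with step-lift step
  ... | w , δ , δ≤2 , lift rewrite wind-exact {a} {b} {w} lift (≤-<-trans δ≤2 (m≤m+n 3 k)) =
    ≤-trans (m≤m+n _ δ) (≤-reflexive lift) ,
    +-cancelʳ-≤ 2 _ _ (begin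
      toℕ a + pred N + 2     ≡⟨ +-assoc (toℕ a) (pred N) 2 ⟩
      toℕ a + (pred N + 2)   ≡⟨ cong (toℕ a +_) (+-comm (pred N) 2) ⟩
      toℕ a + suc N          ≡⟨ lift ⟨
      toℕ b + w * N + δ      ≤⟨ +-monoʳ-≤ (toℕ b + w * N) δ≤2 ⟩
      toℕ b + w * N + 2      ∎)
    where open ≤-Reasoning

  toℕ-mod : ∀ y → toℕ (y mod N) ≡ y % N
  toℕ-mod y = toℕ-fromℕ< (m%n<n y N)

  [toℕ-mod+1]%N : ∀ y → (toℕ (y mod N) + 1) % N ≡ (y + 1) % N
  [toℕ-mod+1]%N y = begin-equality
    (toℕ (y mod N) + 1) % N       ≡⟨ cong (λ x → (x + 1) % N) (toℕ-mod y) ⟩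
    (y % N + 1) % N               ≡⟨ %-distribˡ-+ (y % N) 1 N ⟩
    (y % N % N + 1 % N) % N       ≡⟨ cong (λ x → (x + 1 % N) % N) (m%n%n≡m%n y N) ⟩
    (y % N + 1 % N) % N           ≡⟨ %-distribˡ-+ y 1 N ⟨
    (y + 1) % N                   ∎
    where open ≤-Reasoning

  mod-step : ∀ {y y′} → y + pred N ≤ y′ → y′ ≤ y + suc N → Step N (y mod N) (y′ mod N)
  mod-step {y} lo hi with m≤n⇒∃[o]m+o≡n lo
  ... | 0 , refl = inj₂ (inj₂ (begin-equality
    toℕ (y mod N)                     ≡⟨ toℕ-mod y ⟩
    y % N                             ≡⟨ [m+n]%n≡m%n y N ⟨
    (y + N) % N                       ≡⟨ cong (_% N) (eq y k) ⟩
    (y + pred N + 0 + 1) % N          ≡⟨ [toℕ-mod+1]%N (y + pred N + 0) ⟨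
    (toℕ ((y + pred N + 0) mod N) + 1) % N ∎))
    where
    open ≤-Reasoning
    eq : ∀ y k → y + (3 + k) ≡ y + (2 + k) + 0 + 1
    eq = solve-∀
  ... | 1 , refl = inj₁ (toℕ-injective (begin-equality
    toℕ (y mod N)                     ≡⟨ toℕ-mod y ⟩
    y % N                             ≡⟨ [m+n]%n≡m%n y N ⟨
    (y + N) % N                       ≡⟨ cong (_% N) (eq y k) ⟩
    (y + pred N + 1) % N              ≡⟨ toℕ-mod (y + pred N + 1) ⟨
    toℕ ((y + pred N + 1) mod N)      ∎))
    where
    open ≤-Reasoning
    eq : ∀ y k → y + (3 + k) ≡ y + (2 + k) + 1
    eq = solve-∀
  ... | 2 , refl = inj₂ (inj₁ (begin-equality
    toℕ ((y + pred N + 2) mod N)      ≡⟨ toℕ-mod (y + pred N + 2) ⟩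
    (y + pred N + 2) % N              ≡⟨ cong (_% N) (eq y k) ⟩
    (y + 1 + N) % N                   ≡⟨ [m+n]%n≡m%n (y + 1) N ⟩
    (y + 1) % N                       ≡⟨ [toℕ-mod+1]%N y ⟨
    (toℕ (y mod N) + 1) % N           ∎))
    where
    open ≤-Reasoning
    eq : ∀ y k → y + (2 + k) + 2 ≡ y + 1 + (3 + k)
    eq = solve-∀
  ... | suc (suc (suc d)) , refl = contradiction (subst (_≤ y + suc N) (eq y k d) hi) (m+1+n≰m (y + suc N))
    where
    eq : ∀ y k d → y + (2 + k) + (3 + d) ≡ y + (4 + k) + suc d
    eq = solve-∀

  winding : ∀ {r} → Pos N r → Pos N r → ℕ
  winding R R′ = sum λ i → wind (R i) (R′ i)

  position-step : ∀ {r} (R R′ : Pos N (suc r)) → TeamStep N (suc r) R R′ → ∀ {t} → liftCount R 0 < t →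
                  position R t + pred N ≤ position R′ (t + winding R R′) ×
                  position R′ (t + winding R R′) ≤ position R t + suc N
  position-step R R′ moves {t} R0<t =
    position-shiftˡ R R′ w (proj₂ ∘ step-moves ∘ moves) t R0<t ,
    position-shiftʳ R R′ w (proj₁ ∘ step-moves ∘ moves) t
    where w = λ i → wind (R i) (R′ i)

  step? : ∀ a b → Dec (Step N a b)
  step? a b = (a ≟ᶠ b) ⊎-dec ((toℕ b ≟ (toℕ a + 1) % N) ⊎-dec (toℕ a ≟ (toℕ b + 1) % N))

  stepTowards : Fin N → Fin N → Fin N
  stepTowards a b with step? a b
  ... | yes _ = b
  ... | no  _ = a

  stepTowards-legal : ∀ a b → Step N a (stepTowards a b)
  stepTowards-legal a b with step? a b
  ... | yes a→b = a→b
  ... | no  _   = inj₁ refl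

  stepTowards-reaches : ∀ {a b} → Step N a b → stepTowards a b ≡ b
  stepTowards-reaches {a} {b} a→b with step? a b
  ... | yes _   = refl
  ... | no  a↛b = contradiction a→b a↛b

module Shadowing (k r-1 m-1 : ℕ) where

  open Cycle k

  r m q : ℕ
  r = suc r-1
  m = suc m-1
  q = ⌈ r / m ⌉

  spies : Pos N r → ℕ → Pos N q
  spies R c j = position R (toℕ j * m + c) mod N

  liftCount-0<index : ∀ (R : Pos N r) {c} → r < c → ∀ j → liftCount R 0 < j * m + c
  liftCount-0<index R r<c j = ≤-<-trans (liftCount-0 R) (<-≤-trans r<c (m≤n+m _ (j * m)))

  spies-step : ∀ R R′ → TeamStep N r R R′ → ∀ {c} → r < c →
               TeamStep N q (spies R c) (spies R′ (c + winding R R′))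
  spies-step R R′ moves {c} r<c j =
    subst (λ t → Step N (spies R c j) (position R′ t mod N)) (+-assoc (toℕ j * m) c _) (mod-step lo hi)
    where
    bounds = position-step R R′ moves (liftCount-0<index R r<c (toℕ j))
    lo = proj₁ bounds
    hi = proj₂ bounds

  index-in-window : ∀ {c u} → c ≤ u → ∃₂ λ j κ → j < q × u < j * m + c + κ * r × j * m + c + κ * r ≤ u + m
  index-in-window {c} {u} c≤u =
    let j , κ , j<q , lo , hi = jm+κr-in-window r m (suc (u ∸ c)) in
    j , κ , j<q ,
    (begin-strict
      u                  ≡⟨ m∸n+n≡m c≤u ⟨
      u ∸ c + c          <⟨ +-monoˡ-< c lo ⟩
      j * m + κ * r + c  ≡⟨ xy∙z≈xz∙y (j * m) (κ * r) c ⟩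
      j * m + c + κ * r  ∎) ,
    (begin
      j * m + c + κ * r  ≡⟨ xy∙z≈xz∙y (j * m) c (κ * r) ⟩
      j * m + κ * r + c  ≤⟨ +-monoˡ-≤ c (s≤s⁻¹ hi) ⟩
      u ∸ c + m + c      ≡⟨ xy∙z≈xz∙y (u ∸ c) m c ⟩
      u ∸ c + c + m      ≡⟨ cong (_+ m) (m∸n+n≡m c≤u) ⟩
      u + m              ∎)
    where open ≤-Reasoning

  spies-cover : ∀ (R : Pos N r) {c} → r < c → ∀ v → m ≤ countAt R v → ∃[ j ] spies R c j ≡ v
  spies-cover R {c} r<c v m≤#v =
    let j , κ , j<q , L<t , t≤L+m = index-in-window c≤L
        t = j * m + c + κ * r
        position[t]≡suc[z] : position R t ≡ suc z
        position[t]≡suc[z] = least-at-jump (liftCount-mono R) (position-least R t) L<t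
          (≤-trans t≤L+m (≤-trans (+-monoʳ-≤ L m≤#v) (liftCount-jump R v c)))
    in fromℕ< j<q , toℕ-injective (begin-equality
    toℕ (position R (toℕ (fromℕ< j<q) * m + c) mod N) ≡⟨ toℕ-mod (position R (toℕ (fromℕ< j<q) * m + c)) ⟩
    position R (toℕ (fromℕ< j<q) * m + c) % N        ≡⟨ cong (λ i → position R (i * m + c) % N) (toℕ-fromℕ< j<q) ⟩
    position R (j * m + c) % N                       ≡⟨ [m+kn]%n≡m%n (position R (j * m + c)) κ N ⟨
    (position R (j * m + c) + κ * N) % N             ≡⟨ cong (_% N) (position-+kr R (liftCount-0<index R r<c j) κ) ⟨
    position R t % N                                 ≡⟨ cong (_% N) position[t]≡suc[z] ⟩
    suc z % N                                        ≡⟨ cong (_% N) (+-suc (toℕ v) _) ⟨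
    (toℕ v + suc c * N) % N                          ≡⟨ [m+kn]%n≡m%n (toℕ v) (suc c) N ⟩
    toℕ v % N                                        ≡⟨ m<n⇒m%n≡m (toℕ<n v) ⟩
    toℕ v                                            ∎)
    where
    open ≤-Reasoning
    z = toℕ v + (pred N + c * N)
    L = liftCount R z
    c≤L : c ≤ L
    c≤L = ≤-trans (liftCount-unbounded R c) (liftCount-mono R (≤-trans (m≤n+m (c * N) (pred N)) (m≤n+m _ (toℕ v))))

  Config : Set
  Config = Conf N r q

  -- Spy 0 shadows lift number 'offset', which starts above r ≥ liftCount R 0 as position-step requires.
  offset : List Config → Config → ℕ
  offset []       _ = suc r
  offset (c′ ∷ h) c = offset h c′ + winding (proj₁ c′) (proj₁ c)

  r<offset : ∀ h c → r < offset h c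
  r<offset []       _ = ≤-refl
  r<offset (c′ ∷ h) c = ≤-trans (r<offset h c′) (m≤m+n _ _)

  target : List Config → Config → Pos N r → Pos N q
  target h c R′ = spies R′ (offset h c + winding (proj₁ c) R′)

  shadow : SpyStrategy N r q
  shadow = record
    { init       = λ R → spies R (suc r)
    ; move       = λ h c R′ j → stepTowards (proj₂ c j) (target h c R′ j)
    ; move-legal = λ h c R′ j → stepTowards-legal (proj₂ c j) (target h c R′ j)
    }

  OnTrack : List Config × Config → Set
  OnTrack (h , (R , S)) = ∀ j → S j ≡ spies R (offset h (R , S)) j

  on-track : ∀ ρ k → OnTrack (play shadow ρ k)
  on-track ρ zero    j = refl
  on-track ρ (suc k) with play shadow ρ k | on-track ρ k
  ... | h , (R , S) | S≡spies = λ j →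
    stepTowards-reaches (subst (λ a → Step N a (target h (R , S) R′ j)) (sym (S≡spies j))
                               (spies-step R R′ (RevStrategy.move-legal ρ h (R , S)) (r<offset h (R , S)) j))
    where R′ = RevStrategy.move ρ h (R , S)

  no-meeting : ∀ hc → OnTrack hc → ¬ UnguardedMeeting N m r q (proj₂ hc)
  no-meeting (h , (R , S)) S≡spies (v , m≤#v , unguarded) =
    let j , spy-at-v = spies-cover R (r<offset h (R , S)) v m≤#v in unguarded j (trans (S≡spies j) spy-at-v)

  shadow-wins : SpiesWin N m r q
  shadow-wins = shadow , λ ρ k → no-meeting (play shadow ρ k) (on-track ρ k)

unguarded-vertex : ∀ {n d s} → s < d → (ι : Fin d → Fin n) → Injective _≡_ _≡_ ι →
                   (S : Pos n s) → ∃[ g ] ∀ j → S j ≢ ι g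
unguarded-vertex {d = d} s<d ι ι-injective S =
  let g , unguarded = ¬∀⟶∃¬ d (λ g → ∃[ j ] S j ≡ ι g) (λ g → any? λ j → S j ≟ᶠ ι g) ¬all-guarded
  in g , λ j S[j]≡ι[g] → unguarded (j , S[j]≡ι[g])
  where
  ¬all-guarded : ¬ (∀ g → ∃[ j ] S j ≡ ι g)
  ¬all-guarded guard = <⇒≱ s<d (injective⇒≤ {f = proj₁ ∘ guard} λ {g} {g′} same-spy →
    ι-injective (trans (sym (proj₂ (guard g))) (trans (cong S same-spy) (proj₂ (guard g′)))))

spies-lose : ∀ n m r .{{_ : NonZero m}} → m ∣ r → r / m ≤ n → ∀ s → s < r / m → ¬ SpiesWin n m r s
spies-lose n m r m∣r d≤n s s<d (σ , σ-wins) =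
  σ-wins standStill 0 (ι g , countAt-run R₀ (ι g) (toℕ g * m) m block-in-range in-block , unguarded)
  where
  d = r / m
  ι : Fin d → Fin n
  ι g = inject≤ g d≤n
  block : Fin r → Fin d
  block i = fromℕ< (m<n*o⇒m/o<n (subst (toℕ i <_) (sym (m/n*n≡m m∣r)) (toℕ<n i)))
  R₀ : Pos n r
  R₀ = ι ∘ block
  standStill : RevStrategy n r s
  standStill = record { init = R₀ ; move = λ _ c → proj₁ c ; move-legal = λ _ _ _ → inj₁ refl }
  unguarded-g = unguarded-vertex s<d ι (λ {g} {g′} → inject≤-injective d≤n d≤n g g′) (SpyStrategy.init σ R₀)
  g = proj₁ unguarded-g
  unguarded = proj₂ unguarded-g
  block-in-range : toℕ g * m + m ≤ r
  block-in-range = begin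
    toℕ g * m + m  ≡⟨ +-comm (toℕ g * m) m ⟩
    suc (toℕ g) * m ≤⟨ *-monoˡ-≤ m (toℕ<n g) ⟩
    d * m          ≡⟨ m/n*n≡m m∣r ⟩
    r              ∎
    where open ≤-Reasoning
  in-block : ∀ i → toℕ g * m ≤ toℕ i → toℕ i < toℕ g * m + m → R₀ i ≡ ι g
  in-block i lo hi = cong ι (toℕ-injective (trans (toℕ-fromℕ< _) ([g*m≤x<g*m+m]⇒x/m≡g m lo hi)))

lemma3 : (n m r : ℕ) → .{{_ : NonZero m}} → 3 ≤ n → 0 < r →
         SpiesWin n m r ⌈ r / m ⌉
         × (m ∣ r → r / m ≤ n → (s : ℕ) → s < r / m → ¬ SpiesWin n m r s)
lemma3 (suc (suc (suc k))) m@(suc m-1) r@(suc r-1) (s≤s (s≤s (s≤s _))) _ =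
  Shadowing.shadow-wins k r-1 m-1 , spies-lose (3 + k) m r
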